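{- Let $a,c,d,e$ be indeterminates, and for parameters $(a,c,d,e)$ let $\mathbf{T}(a,c,d,e)=(T(n,k))_{n,k\ge0}$ be defined by $T(0,k)=\delta_{k0}$ and, for $n\ge1$, $T(n,k)=[a(n-k)+c]\,T(n-1,k-1)+(dk+e)\,T(n-1,k)$, with the convention $T(n,k):=0$ if $n<0$ or $k<0$. (i) The matrix $\mathbf{T}=\mathbf{T}(0,c,d,e)$ satisfies, for all $n\ge1$ and $k\ge 0$, \[ T(n,k)=e\,T(n-1,k)+\sum_{m=0}^{n-1}\binom{n-1}{m}d^m c\,T(n-1-m,k-1). \] (ii) The matrix $\mathbf{T}=\mathbf{T}(a,c,0,e)$ satisfies, for all $n\ge1$ and $k\ge 0$, \[ T(n,k)=c\,T(n-1,k-1)+\sum_{m=0}^{n-1}\binom{n-1}{m}a^m e\,T(n-1-m,k-m). \] -}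

module Defs where

open import Level using (Level)
open import Algebra.Bundles using (CommutativeRing)
open import Data.Nat as ℕ using (ℕ; zero; suc)
open import Data.Integer as ℤ using (ℤ; +_; -[1+_])

module _ {c ℓ : Level} (R : CommutativeRing c ℓ) where
  open CommutativeRing R

  natR : ℕ → Carrier
  natR zero    = 0#
  natR (suc n) = 1# + natR n

  intR : ℤ → Carrier
  intR (+ n)      = natR n
  intR -[1+ n ]   = - natR (suc n)

  powR : Carrier → ℕ → Carrier
  powR x zero    = 1#
  powR x (suc m) = x * powR x m

  sumR : ℕ → (ℕ → Carrier) → Carrier
  sumR zero    f = 0#
  sumR (suc n) f = sumR n f + f n

  -- T(n,k) for the matrix T(a,c,d,e); the column index k ranges over ℤ
  -- so that the convention T(n,k) = 0 for k < 0 is built in.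
  T : (a c' d e : Carrier) → ℕ → ℤ → Carrier
  T a c' d e zero    (+ zero)    = 1#
  T a c' d e zero    (+ suc k)   = 0#
  T a c' d e zero    -[1+ k ]    = 0#
  T a c' d e (suc n) -[1+ k ]    = 0#
  T a c' d e (suc n) (+ k)       =
      (a * intR (+ suc n ℤ.- + k) + c') * T a c' d e n (+ k ℤ.- + 1)
    + (d * natR k + e) * T a c' d e n (+ k)

-- Let S(n, j) = Σ_{m ≤ n} C(n,m) x^m T(n-m, j-σm), with x = d, σ = 0 in (i) and
-- x = a, σ = 1 in (ii). Pascal's rule splits S(n+1, j) into the same sum over the rows
-- n+1-m plus x·S(n, j-σ). The recurrence of T can be applied under the sum because its
-- coefficients are constant along the lines summed over (dk + e does not depend on the
-- row, and a(n-k) + c only on n - k), so S obeys the recurrence of T with one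
-- coefficient increased by x.
module Submission where

open import Defs
open import Level using (Level)
open import Algebra.Bundles using (CommutativeRing)
open import Data.Nat as ℕ using (ℕ; zero; suc; _∸_; _≤_; _<_)
import Data.Nat.Properties as ℕ
open import Data.Nat.Combinatorics using (_C_; nCk+nC[k+1]≡[n+1]C[k+1]; k>n⇒nCk≡0)
open import Data.Integer as ℤ using (ℤ; +_; -[1+_]; 1ℤ) renaming (_-_ to _-ℤ_)
import Data.Integer.Properties as ℤ
open import Data.Integer.Tactic.RingSolver using (solve-∀)
open import Data.Product using (_×_; _,_)
open import Relation.Binary.PropositionalEquality as ≡ using (_≡_)

+[n∸m]≡+n-+m : ∀ {m n} → m ≤ n → + (n ∸ m) ≡ + n ℤ.- + m
+[n∸m]≡+n-+m {m} {n} m≤n = ≡.trans (≡.sym (ℤ.≤-⊖ m≤n)) (≡.sym (ℤ.m-n≡m⊖n n m))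

i-[1+m]≡[i-1]-m : ∀ (i m : ℤ) → i ℤ.- (1ℤ ℤ.+ m) ≡ (i ℤ.- 1ℤ) ℤ.- m
i-[1+m]≡[i-1]-m = solve-∀

[i-m]-1≡[i-1]-m : ∀ (i m : ℤ) → (i ℤ.- m) ℤ.- 1ℤ ≡ (i ℤ.- 1ℤ) ℤ.- m
[i-m]-1≡[i-1]-m = solve-∀

[1+[n-m]]-[i-m]≡[1+n]-i : ∀ (n m i : ℤ) → (1ℤ ℤ.+ (n ℤ.- m)) ℤ.- (i ℤ.- m) ≡ (1ℤ ℤ.+ n) ℤ.- i
[1+[n-m]]-[i-m]≡[1+n]-i = solve-∀

[1+n]-[i-1]≡[2+n]-i : ∀ (n i : ℤ) → (1ℤ ℤ.+ n) ℤ.- (i ℤ.- 1ℤ) ≡ (1ℤ ℤ.+ (1ℤ ℤ.+ n)) ℤ.- i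
[1+n]-[i-1]≡[2+n]-i = solve-∀

[[2+n]-i]-1≡[1+n]-i : ∀ (n i : ℤ) → ((1ℤ ℤ.+ (1ℤ ℤ.+ n)) ℤ.- i) ℤ.- 1ℤ ≡ (1ℤ ℤ.+ n) ℤ.- i
[[2+n]-i]-1≡[1+n]-i = solve-∀

module _ {c ℓ : Level} (R : CommutativeRing c ℓ) where
  open CommutativeRing R
  open import Algebra.Solver.Ring.NaturalCoefficients.Default commutativeSemiring
  open import Algebra.Properties.Ring ring using (-‿+-comm)
  open import Relation.Binary.Reasoning.Setoid setoid

  sumR-cong< : ∀ n {f g : ℕ → Carrier} → (∀ m → m < n → f m ≈ g m) → sumR R n f ≈ sumR R n g
  sumR-cong< zero    f≈g = refl
  sumR-cong< (suc n) f≈g = +-cong (sumR-cong< n (λ m m<n → f≈g m (ℕ.m<n⇒m<1+n m<n))) (f≈g n (ℕ.n<1+n n))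

  sumR-+ : ∀ n (f g : ℕ → Carrier) → sumR R n (λ m → f m + g m) ≈ sumR R n f + sumR R n g
  sumR-+ zero    f g = sym (+-identityˡ 0#)
  sumR-+ (suc n) f g = trans (+-congʳ (sumR-+ n f g))
    (solve 4 (λ u v x y → (u :+ v) :+ (x :+ y) := (u :+ x) :+ (v :+ y)) refl _ _ (f n) (g n))

  *-distribˡ-sumR : ∀ n x (f : ℕ → Carrier) → x * sumR R n f ≈ sumR R n (λ m → x * f m)
  *-distribˡ-sumR zero    x f = zeroʳ x
  *-distribˡ-sumR (suc n) x f = trans (distribˡ x _ _) (+-congʳ (*-distribˡ-sumR n x f))

  sumR-head : ∀ n (f : ℕ → Carrier) → sumR R (suc n) f ≈ f 0 + sumR R n (λ m → f (suc m))
  sumR-head zero    f = +-comm 0# (f 0)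
  sumR-head (suc n) f = trans (+-congʳ (sumR-head n f)) (+-assoc _ _ _)

  natR-+ : ∀ m n → natR R (m ℕ.+ n) ≈ natR R m + natR R n
  natR-+ zero    n = sym (+-identityˡ _)
  natR-+ (suc m) n = trans (+-congˡ (natR-+ m n)) (sym (+-assoc _ _ _))

  natR-pascal : ∀ n m → natR R (suc n C suc m) ≈ natR R (n C m) + natR R (n C suc m)
  natR-pascal n m = trans (reflexive (≡.cong (natR R) (≡.sym (nCk+nC[k+1]≡[n+1]C[k+1] n m))))
                          (natR-+ (n C m) (n C suc m))

  intR-pred : ∀ i → intR R i ≈ 1# + intR R (i ℤ.- 1ℤ)
  intR-pred (+ zero)  = sym (trans (+-congʳ (sym (+-identityʳ 1#))) (-‿inverseʳ _))
  intR-pred (+ suc k) = refl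
  intR-pred -[1+ k ]  = begin
      - b                                    ≈⟨ sym (+-identityˡ _) ⟩
      0# + - b                               ≈⟨ +-congʳ (sym (-‿inverseʳ 1#)) ⟩
      (1# + - 1#) + - b                      ≈⟨ +-assoc _ _ _ ⟩
      1# + (- 1# + - b)                      ≈⟨ +-congˡ (-‿+-comm 1# b) ⟩
      1# + - (1# + b)                        ≈⟨ +-congˡ (-‿cong (+-congˡ (+-congˡ k≈k+0))) ⟩
      1# + - (1# + (1# + natR R (k ℕ.+ 0)))  ∎
    where
    b = 1# + natR R k
    k≈k+0 = reflexive (≡.cong (natR R) (≡.sym (ℕ.+-identityʳ k)))

  binomialSum : Carrier → ℕ → (ℕ → ℕ → Carrier) → Carrier
  binomialSum x n g = sumR R (suc n) (λ m → natR R (n C m) * powR R x m * g (n ∸ m) m)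

  binomialSum-cong : ∀ x n (g h : ℕ → ℕ → Carrier) →
    (∀ m → m ≤ n → g (n ∸ m) m ≈ h (n ∸ m) m) → binomialSum x n g ≈ binomialSum x n h
  binomialSum-cong x n g h g≈h = sumR-cong< (suc n) (λ m m<1+n → *-congˡ (g≈h m (ℕ.s≤s⁻¹ m<1+n)))

  binomialSum-zero : ∀ x (g : ℕ → ℕ → Carrier) → binomialSum x 0 g ≈ g 0 0
  binomialSum-zero x g = solve 1 (λ y → con 0 :+ (con 1 :+ con 0) :* con 1 :* y := y) refl (g 0 0)

  binomialSum-linear : ∀ x n u v (g h : ℕ → ℕ → Carrier) →
    binomialSum x n (λ r m → u * g r m + v * h r m) ≈ u * binomialSum x n g + v * binomialSum x n h
  binomialSum-linear x n u v g h = begin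
      binomialSum x n (λ r m → u * g r m + v * h r m)
    ≈⟨ sumR-cong< (suc n) (λ m _ → solve 5 (λ p u y v z → p :* (u :* y :+ v :* z) := u :* (p :* y) :+ v :* (p :* z))
                                           refl _ u _ v _) ⟩
      sumR R (suc n) (λ m → u * G m + v * H m)
    ≈⟨ sumR-+ (suc n) _ _ ⟩
      sumR R (suc n) (λ m → u * G m) + sumR R (suc n) (λ m → v * H m)
    ≈⟨ sym (+-cong (*-distribˡ-sumR (suc n) u G) (*-distribˡ-sumR (suc n) v H)) ⟩
      u * binomialSum x n g + v * binomialSum x n h
    ∎
    where
    G H : ℕ → Carrier
    G m = natR R (n C m) * powR R x m * g (n ∸ m) m
    H m = natR R (n C m) * powR R x m * h (n ∸ m) m

  binomialSum-suc : ∀ x n (g : ℕ → ℕ → Carrier) →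
    binomialSum x (suc n) g ≈ binomialSum x n (λ r → g (suc r)) + x * binomialSum x n (λ r m → g r (suc m))
  binomialSum-suc x n g = begin
      binomialSum x (suc n) g
    ≈⟨ sumR-head (suc n) _ ⟩
      F0 + sumR R (suc n) (λ m → natR R (suc n C suc m) * (x * powR R x m) * G m)
    ≈⟨ +-congˡ (trans (sumR-cong< (suc n) (λ m _ → pascal m)) (sumR-+ (suc n) _ _)) ⟩
      F0 + (sumR R (suc n) (λ m → x * L m) + (sumR R n Q + Q n))
    ≈⟨ +-congˡ (+-cong (sym (*-distribˡ-sumR (suc n) x L)) (+-congˡ Qn≈0)) ⟩
      F0 + (x * binomialSum x n (λ r m → g r (suc m)) + (sumR R n Q + 0#))
    ≈⟨ solve 3 (λ f s q → f :+ (s :+ (q :+ con 0)) := (f :+ q) :+ s) refl F0 _ _ ⟩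
      (F0 + sumR R n Q) + x * binomialSum x n (λ r m → g r (suc m))
    ≈⟨ +-congʳ (sym (sumR-head n _)) ⟩
      sumR R (suc n) (λ m → natR R (n C m) * powR R x m * g (suc n ∸ m) m)
        + x * binomialSum x n (λ r m → g r (suc m))
    ≈⟨ +-congʳ (sumR-cong< (suc n) (λ m m<1+n → *-congˡ (reflexive (≡.cong (λ r → g r m) (1+n∸m m<1+n))))) ⟩
      binomialSum x n (λ r → g (suc r)) + x * binomialSum x n (λ r m → g r (suc m))
    ∎
    where
    F0 : Carrier
    F0 = natR R (suc n C 0) * powR R x 0 * g (suc n) 0
    G L Q : ℕ → Carrier
    G m = g (n ∸ m) (suc m)
    L m = natR R (n C m) * powR R x m * G m
    Q m = natR R (n C suc m) * (x * powR R x m) * G m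
    pascal : ∀ m → natR R (suc n C suc m) * (x * powR R x m) * G m ≈ x * L m + Q m
    pascal m = trans (*-congʳ (*-congʳ (natR-pascal n m)))
      (solve 5 (λ p q x y z → (p :+ q) :* (x :* y) :* z := x :* (p :* y :* z) :+ q :* (x :* y) :* z)
               refl _ _ x _ _)
    1+n∸m : ∀ {m} → m < suc n → suc n ∸ m ≡ suc (n ∸ m)
    1+n∸m m<1+n = ℕ.+-∸-assoc 1 (ℕ.s≤s⁻¹ m<1+n)
    Qn≈0 : Q n ≈ 0#
    Qn≈0 = trans (*-congʳ (*-congʳ (reflexive (≡.cong (natR R) (k>n⇒nCk≡0 (ℕ.n<1+n n))))))
                 (trans (*-congʳ (zeroˡ _)) (zeroˡ _))

  *-distribˡ-binomialSum : ∀ x y n (g : ℕ → ℕ → Carrier) →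
    x * binomialSum y n g ≈ sumR R (suc n) (λ m → natR R (n C m) * powR R y m * x * g (n ∸ m) m)
  *-distribˡ-binomialSum x y n g = trans (*-distribˡ-sumR (suc n) x _)
    (sumR-cong< (suc n) (λ m _ → solve 3 (λ x p z → x :* (p :* z) := p :* x :* z) refl x _ _))

  T-negative : ∀ {a c' d e} n k → T R a c' d e n -[1+ k ] ≡ 0#
  T-negative zero    k = ≡.refl
  T-negative (suc n) k = ≡.refl

  T-suc : ∀ a c' d e n j →
    T R a c' d e (suc n) j
      ≈ (a * intR R (+ suc n ℤ.- j) + c') * T R a c' d e n (j ℤ.- 1ℤ)
        + (d * intR R j + e) * T R a c' d e n j
  T-suc a c' d e n (+ k)    = refl
  T-suc a c' d e n -[1+ k ] =
    sym (trans (+-cong (vanish (T-negative n _)) (vanish (T-negative n k))) (+-identityʳ 0#))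
    where
    vanish : ∀ {x y} → y ≡ 0# → x * y ≈ 0#
    vanish {x} y≡0 = trans (*-congˡ (reflexive y≡0)) (zeroʳ x)

  module ZeroA (c' d e : Carrier) where
    T₀ : ℕ → ℤ → Carrier
    T₀ = T R 0# c' d e

    β : ℤ → Carrier
    β j = d * intR R j + e

    β-pred : ∀ j → β j ≈ β (j ℤ.- 1ℤ) + d
    β-pred j = trans (+-congʳ (*-congˡ (intR-pred j)))
      (solve 3 (λ d i e → d :* (con 1 :+ i) :+ e := (d :* i :+ e) :+ d) refl d _ e)

    T₀-suc : ∀ n j → T₀ (suc n) j ≈ c' * T₀ n (j ℤ.- 1ℤ) + β j * T₀ n j
    T₀-suc n j = trans (T-suc 0# c' d e n j) (+-congʳ (*-congʳ (trans (+-congʳ (zeroˡ _)) (+-identityˡ c'))))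

    β*T₀-zero : ∀ j → β j * T₀ 0 j ≈ e * T₀ 0 j
    β*T₀-zero (+ zero)  = *-congʳ (trans (+-congʳ (zeroʳ d)) (+-identityˡ e))
    β*T₀-zero (+ suc k) = trans (zeroʳ _) (sym (zeroʳ e))
    β*T₀-zero -[1+ k ]  = trans (zeroʳ _) (sym (zeroʳ e))

    S : ℕ → ℤ → Carrier
    S n j = binomialSum d n (λ r _ → T₀ r j)

    S-suc : ∀ n j → S (suc n) j ≈ c' * S n (j ℤ.- 1ℤ) + (β j + d) * S n j
    S-suc n j = begin
        S (suc n) j
      ≈⟨ binomialSum-suc d n (λ r _ → T₀ r j) ⟩
        binomialSum d n (λ r _ → T₀ (suc r) j) + d * S n j
      ≈⟨ +-congʳ (binomialSum-cong d n (λ r _ → T₀ (suc r) j)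
                                       (λ r _ → c' * T₀ r (j ℤ.- 1ℤ) + β j * T₀ r j)
                                       (λ m _ → T₀-suc (n ∸ m) j)) ⟩
        binomialSum d n (λ r _ → c' * T₀ r (j ℤ.- 1ℤ) + β j * T₀ r j) + d * S n j
      ≈⟨ +-congʳ (binomialSum-linear d n c' (β j) (λ r _ → T₀ r (j ℤ.- 1ℤ)) (λ r _ → T₀ r j)) ⟩
        (c' * S n (j ℤ.- 1ℤ) + β j * S n j) + d * S n j
      ≈⟨ solve 5 (λ c u b v d → (c :* u :+ b :* v) :+ d :* v := c :* u :+ (b :+ d) :* v)
                 refl c' _ (β j) _ d ⟩
        c' * S n (j ℤ.- 1ℤ) + (β j + d) * S n j
      ∎

    T₀-suc-binomial : ∀ n j → T₀ (suc n) j ≈ e * T₀ n j + c' * S n (j ℤ.- 1ℤ)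
    T₀-suc-binomial zero j = begin
        T₀ 1 j                               ≈⟨ T₀-suc 0 j ⟩
        c' * T₀ 0 (j ℤ.- 1ℤ) + β j * T₀ 0 j  ≈⟨ +-comm _ _ ⟩
        β j * T₀ 0 j + c' * T₀ 0 (j ℤ.- 1ℤ)  ≈⟨ +-cong (β*T₀-zero j) (*-congˡ T₀0≈S0) ⟩
        e * T₀ 0 j + c' * S 0 (j ℤ.- 1ℤ)     ∎
      where
      T₀0≈S0 : T₀ 0 (j ℤ.- 1ℤ) ≈ S 0 (j ℤ.- 1ℤ)
      T₀0≈S0 = sym (binomialSum-zero d (λ r _ → T₀ r (j ℤ.- 1ℤ)))
    T₀-suc-binomial (suc n) j = begin
        T₀ (suc (suc n)) j
      ≈⟨ T₀-suc (suc n) j ⟩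
        c' * T₀ (suc n) (j ℤ.- 1ℤ) + β j * T₀ (suc n) j
      ≈⟨ +-cong (*-congˡ (T₀-suc-binomial n (j ℤ.- 1ℤ))) (*-congˡ (T₀-suc-binomial n j)) ⟩
        c' * (e * T₀ n (j ℤ.- 1ℤ) + c' * S n ((j ℤ.- 1ℤ) ℤ.- 1ℤ))
          + β j * (e * T₀ n j + c' * S n (j ℤ.- 1ℤ))
      ≈⟨ solve 7 (λ c e b t s u v → c :* (e :* t :+ c :* s) :+ b :* (e :* u :+ c :* v)
                                 := e :* (c :* t :+ b :* u) :+ c :* (c :* s :+ b :* v))
                 refl c' e (β j) _ _ _ _ ⟩
        e * (c' * T₀ n (j ℤ.- 1ℤ) + β j * T₀ n j)
          + c' * (c' * S n ((j ℤ.- 1ℤ) ℤ.- 1ℤ) + β j * S n (j ℤ.- 1ℤ))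
      ≈⟨ sym (+-cong (*-congˡ (T₀-suc n j))
                     (*-congˡ (trans (S-suc n (j ℤ.- 1ℤ)) (+-congˡ (*-congʳ (sym (β-pred j))))))) ⟩
        e * T₀ (suc n) j + c' * S (suc n) (j ℤ.- 1ℤ)
      ∎

  module ZeroD (a c' e : Carrier) where
    T₀ : ℕ → ℤ → Carrier
    T₀ = T R a c' 0# e

    α : ℕ → ℤ → Carrier
    α n j = a * intR R (+ suc n ℤ.- j) + c'

    α-suc : ∀ n j → α (suc n) j ≈ α n j + a
    α-suc n j = trans (+-congʳ (*-congˡ (trans (intR-pred (+ suc (suc n) ℤ.- j))
                                               (+-congˡ (reflexive (≡.cong (intR R) ([[2+n]-i]-1≡[1+n]-i (+ n) j)))))))
      (solve 3 (λ a i c → a :* (con 1 :+ i) :+ c := (a :* i :+ c) :+ a) refl a _ c')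

    α-pred : ∀ n j → α n (j ℤ.- 1ℤ) ≡ α (suc n) j
    α-pred n j = ≡.cong (λ i → a * intR R i + c') ([1+n]-[i-1]≡[2+n]-i (+ n) j)

    α-diagonal : ∀ {m n} j → m ≤ n → α (n ∸ m) (j ℤ.- + m) ≡ α n j
    α-diagonal {m} {n} j m≤n = ≡.cong (λ i → a * intR R i + c') (≡.trans
      (≡.cong (λ i → (1ℤ ℤ.+ i) ℤ.- (j ℤ.- + m)) (+[n∸m]≡+n-+m m≤n)) ([1+[n-m]]-[i-m]≡[1+n]-i (+ n) (+ m) j))

    T₀-suc : ∀ n j → T₀ (suc n) j ≈ α n j * T₀ n (j ℤ.- 1ℤ) + e * T₀ n j
    T₀-suc n j = trans (T-suc a c' 0# e n j) (+-congˡ (*-congʳ (trans (+-congʳ (zeroˡ _)) (+-identityˡ e))))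

    α*T₀-zero : ∀ j → α 0 j * T₀ 0 (j ℤ.- 1ℤ) ≈ c' * T₀ 0 (j ℤ.- 1ℤ)
    α*T₀-zero (+ zero)        = trans (zeroʳ _) (sym (zeroʳ c'))
    α*T₀-zero (+ suc zero)    = *-congʳ (trans (+-congʳ (zeroʳ a)) (+-identityˡ c'))
    α*T₀-zero (+ suc (suc k)) = trans (zeroʳ _) (sym (zeroʳ c'))
    α*T₀-zero -[1+ k ]        = trans (zeroʳ _) (sym (zeroʳ c'))

    T₀-along : ℤ → ℕ → ℕ → Carrier
    T₀-along j r m = T₀ r (j ℤ.- + m)

    S : ℕ → ℤ → Carrier
    S n j = binomialSum a n (T₀-along j)

    S-suc : ∀ n j → S (suc n) j ≈ (α n j + a) * S n (j ℤ.- 1ℤ) + e * S n j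
    S-suc n j = begin
        S (suc n) j
      ≈⟨ binomialSum-suc a n (T₀-along j) ⟩
        binomialSum a n (λ r m → T₀ (suc r) (j ℤ.- + m)) + a * binomialSum a n (λ r m → T₀ r (j ℤ.- + suc m))
      ≈⟨ +-cong (binomialSum-cong a n (λ r → T₀-along j (suc r))
                                      (λ r m → α n j * T₀-along (j ℤ.- 1ℤ) r m + e * T₀-along j r m) recurse)
                (*-congˡ (binomialSum-cong a n (λ r m → T₀-along j r (suc m)) (T₀-along (j ℤ.- 1ℤ)) shift)) ⟩
        binomialSum a n (λ r m → α n j * T₀ r ((j ℤ.- 1ℤ) ℤ.- + m) + e * T₀ r (j ℤ.- + m)) + a * S n (j ℤ.- 1ℤ)
      ≈⟨ +-congʳ (binomialSum-linear a n (α n j) e (T₀-along (j ℤ.- 1ℤ)) (T₀-along j)) ⟩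
        (α n j * S n (j ℤ.- 1ℤ) + e * S n j) + a * S n (j ℤ.- 1ℤ)
      ≈⟨ solve 5 (λ α u e v a → (α :* u :+ e :* v) :+ a :* u := (α :+ a) :* u :+ e :* v)
                 refl (α n j) _ e _ a ⟩
        (α n j + a) * S n (j ℤ.- 1ℤ) + e * S n j
      ∎
      where
      recurse : ∀ m → m ≤ n →
        T₀ (suc (n ∸ m)) (j ℤ.- + m) ≈ α n j * T₀ (n ∸ m) ((j ℤ.- 1ℤ) ℤ.- + m) + e * T₀ (n ∸ m) (j ℤ.- + m)
      recurse m m≤n = trans (T₀-suc (n ∸ m) (j ℤ.- + m))
        (+-congʳ (*-cong (reflexive (α-diagonal j m≤n))
                         (reflexive (≡.cong (T₀ (n ∸ m)) ([i-m]-1≡[i-1]-m j (+ m))))))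
      shift : ∀ m → m ≤ n → T₀ (n ∸ m) (j ℤ.- + suc m) ≈ T₀ (n ∸ m) ((j ℤ.- 1ℤ) ℤ.- + m)
      shift m _ = reflexive (≡.cong (T₀ (n ∸ m)) (i-[1+m]≡[i-1]-m j (+ m)))

    T₀-suc-binomial : ∀ n j → T₀ (suc n) j ≈ c' * T₀ n (j ℤ.- 1ℤ) + e * S n j
    T₀-suc-binomial zero j = begin
        T₀ 1 j                                            ≈⟨ T₀-suc 0 j ⟩
        α 0 j * T₀ 0 (j ℤ.- 1ℤ) + e * T₀ 0 j              ≈⟨ +-cong (α*T₀-zero j) (*-congˡ T₀0≈S0) ⟩
        c' * T₀ 0 (j ℤ.- 1ℤ) + e * S 0 j                  ∎
      where
      T₀0≈S0 : T₀ 0 j ≈ S 0 j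
      T₀0≈S0 = sym (trans (binomialSum-zero a (T₀-along j)) (reflexive (≡.cong (T₀ 0) (ℤ.+-identityʳ j))))
    T₀-suc-binomial (suc n) j = begin
        T₀ (suc (suc n)) j
      ≈⟨ T₀-suc (suc n) j ⟩
        α (suc n) j * T₀ (suc n) (j ℤ.- 1ℤ) + e * T₀ (suc n) j
      ≈⟨ +-cong (*-congˡ (T₀-suc-binomial n (j ℤ.- 1ℤ))) (*-congˡ (T₀-suc-binomial n j)) ⟩
        α (suc n) j * (c' * T₀ n ((j ℤ.- 1ℤ) ℤ.- 1ℤ) + e * S n (j ℤ.- 1ℤ))
          + e * (c' * T₀ n (j ℤ.- 1ℤ) + e * S n j)
      ≈⟨ solve 7 (λ α c e t s u v → α :* (c :* t :+ e :* s) :+ e :* (c :* u :+ e :* v)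
                                 := c :* (α :* t :+ e :* u) :+ e :* (α :* s :+ e :* v))
                 refl (α (suc n) j) c' e _ _ _ _ ⟩
        c' * (α (suc n) j * T₀ n ((j ℤ.- 1ℤ) ℤ.- 1ℤ) + e * T₀ n (j ℤ.- 1ℤ))
          + e * (α (suc n) j * S n (j ℤ.- 1ℤ) + e * S n j)
      ≈⟨ sym (+-cong (*-congˡ (trans (T₀-suc n (j ℤ.- 1ℤ)) (+-congʳ (*-congʳ (reflexive (α-pred n j))))))
                     (*-congˡ (trans (S-suc n j) (+-congʳ (*-congʳ (sym (α-suc n j))))))) ⟩
        c' * T₀ (suc n) (j ℤ.- 1ℤ) + e * S (suc n) j
      ∎

lemma2p2 : ∀ {c ℓ : Level} (R : CommutativeRing c ℓ) →
    let open CommutativeRing R in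
    (a c' d e : Carrier) →
    (∀ (n k : ℕ) →
      T R 0# c' d e (suc n) (+ k)
        ≈ e * T R 0# c' d e n (+ k)
          + sumR R (suc n) (λ m → natR R (n C m) * powR R d m * c' * T R 0# c' d e (n ∸ m) (+ k -ℤ + 1)))
    ×
    (∀ (n k : ℕ) →
      T R a c' 0# e (suc n) (+ k)
        ≈ c' * T R a c' 0# e n (+ k -ℤ + 1)
          + sumR R (suc n) (λ m → natR R (n C m) * powR R a m * e * T R a c' 0# e (n ∸ m) (+ k -ℤ + m)))
lemma2p2 R a c' d e =
    (λ n k → trans (ZeroA.T₀-suc-binomial R c' d e n (+ k))
                   (+-congˡ (*-distribˡ-binomialSum R c' d n (λ r _ → ZeroA.T₀ R c' d e r (+ k -ℤ + 1)))))
  , (λ n k → trans (ZeroD.T₀-suc-binomial R a c' e n (+ k))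
                   (+-congˡ (*-distribˡ-binomialSum R e a n (ZeroD.T₀-along R a c' e (+ k)))))
  where open CommutativeRing R
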